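{- A geometric precubical set $C$ lifts at most once the inclusion $\partial Yn\hookrightarrow Yn$ for every $n\ge1$ (every morphism $\partial Yn\to C$ has at most one extension to $Yn$). In particular $C$ has no parallel edges. Moreover $C$ satisfies the at most one square closing property.
   Context: A precubical set $C$: sets $C(n)$ with faces $\partial^\epsilon_{i,n}:C(n+1)\to C(n)$ satisfying $\partial^\epsilon_{j,n}\partial^{\epsilon'}_{i,n+1}=\partial^{\epsilon'}_{i,n}\partial^\epsilon_{j+1,n+1}$ for $i\le j$; equivalently a presheaf on the precubical category $\square$ generated by $\varepsilon^\epsilon_{i,n}:n\to n+1$ with the dual relations. Iterated faces: $C(\phi)(c)$ for $\phi:m\to n$. Geometric: (1) $C(\phi)(c)=C(\psi)(c)$ implies $\phi=\psi$; (2) any two cubes with a common iterated face have a maximal common iterated face. Standard $n$-cube $Yn$: strings in $\{ -,0,+\}^n$, $k$-cubes having exactly $k$ zeros, $\partial^\epsilon_i$ replacing the $i$-th zero by $\epsilon$; $\partial Yn=Yn\setminus\{0^n\}$. No parallel edges: two edges with the same source $\partial^-_0$ and target $\partial^+_0$ are equal. At most one square closing property: for each vertex $v\in\{ --,-+,+-,++\}$ of $Y2$, every morphism from $Y2\setminus\{v\}$ (the sub-precubical set of cubes not having $v$ as iterated face) to $C$ has at most one extension to $Y2$. -}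

module Defs where

open import Data.Nat using (ℕ; zero; suc; s≤s)
open import Data.Fin using (Fin; zero; suc; inject₁; _≤_)
open import Data.Product using (Σ; _×_; _,_)
open import Relation.Binary.PropositionalEquality using (_≡_; refl; cong)
open import Relation.Nullary using (¬_)

data Sign : Set where
  minus plus : Sign

record PrecubicalSet : Set₁ where
  field
    cell : ℕ → Set
    face : ∀ {n} → Fin (suc n) → Sign → cell (suc n) → cell n
    cubical : ∀ {n} (i j : Fin (suc n)) → i ≤ j → (ε ε' : Sign) (c : cell (suc (suc n))) →
      face j ε (face (inject₁ i) ε' c) ≡ face i ε' (face (suc j) ε c)

open PrecubicalSet public

-- Strings in {-,0,+}^n with exactly m zeros.  These are the m-cubes of the
-- standard n-cube Yn, equivalently the morphisms m → n of the precubical category.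
data Word : ℕ → ℕ → Set where
  [] : Word 0 0
  _∷s_ : ∀ {m n} → Sign → Word m n → Word m (suc n)
  z∷_ : ∀ {m n} → Word m n → Word (suc m) (suc n)

-- Iterated face action of a word φ : m → n on an n-cube of a graded family with faces.
-- (ε ∷ w) applies ∂^ε_0 then w; (0 ∷ w) applies w on the remaining coordinates
-- (faces shifted by one index).
act : (D : ℕ → Set) (f : ∀ {n} → Fin (suc n) → Sign → D (suc n) → D n) →
      ∀ {m n} → Word m n → D n → D m
act D f [] c = c
act D f (e ∷s w) c = act D f w (f zero e c)
act D f (z∷ w) c = act (λ k → D (suc k)) (λ i e → f (suc i) e) w c

iface : (C : PrecubicalSet) → ∀ {m n} → Word m n → cell C n → cell C m
iface C = act (cell C) (face C)

yface : ∀ {k n} → Fin (suc k) → Sign → Word (suc k) n → Word k n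
yface i e (x ∷s w) = x ∷s yface i e w
yface zero e (z∷ w) = e ∷s w
yface {suc k} (suc i) e (z∷ w) = z∷ yface i e w

ycubical : ∀ {k n} (i j : Fin (suc k)) → i ≤ j → (ε ε' : Sign) (w : Word (suc (suc k)) n) →
  yface j ε (yface (inject₁ i) ε' w) ≡ yface i ε' (yface (suc j) ε w)
ycubical i j p ε ε' (x ∷s w) = cong (x ∷s_) (ycubical i j p ε ε' w)
ycubical zero j p ε ε' (z∷ w) = refl
ycubical {suc k} (suc i) (suc j) (s≤s p) ε ε' (z∷ w) = cong z∷_ (ycubical i j p ε ε' w)

Y : ℕ → PrecubicalSet
Y n = record { cell = λ k → Word k n ; face = yface ; cubical = ycubical }

record Morphism (A B : PrecubicalSet) : Set where
  field
    map : ∀ {k} → cell A k → cell B k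
    commute : ∀ {k} (i : Fin (suc k)) (e : Sign) (a : cell A (suc k)) →
      map (face A i e a) ≡ face B i e (map a)

open Morphism public

-- Morphisms from the sub-precubical set of A given by the (face-closed) predicate P.
record SubMorphism (A : PrecubicalSet) (P : ∀ {k} → cell A k → Set) (B : PrecubicalSet) : Set where
  field
    smap : ∀ {k} (a : cell A k) → P a → cell B k
    scommute : ∀ {k} (i : Fin (suc k)) (e : Sign) (a : cell A (suc k)) (p : P a)
      (q : P (face A i e a)) → smap (face A i e a) q ≡ face B i e (smap a p)

open SubMorphism public

Extends : ∀ {A C} {P : ∀ {k} → cell A k → Set} → Morphism A C → SubMorphism A P C → Set
Extends {A} {C} {P} g f = ∀ {k} (a : cell A k) (p : P a) → map g a ≡ smap f a p

LiftsAtMostOnce : (A : PrecubicalSet) (P : ∀ {k} → cell A k → Set) (C : PrecubicalSet) → Set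
LiftsAtMostOnce A P C = (f : SubMorphism A P C) (g g' : Morphism A C) →
  Extends g f → Extends g' f → ∀ {k} (a : cell A k) → map g a ≡ map g' a

IsFaceOf : (C : PrecubicalSet) → ∀ {m n} → cell C m → cell C n → Set
IsFaceOf C {m} {n} d c = Σ (Word m n) (λ φ → iface C φ c ≡ d)

CommonFace : (C : PrecubicalSet) → ∀ {k n n'} → cell C k → cell C n → cell C n' → Set
CommonFace C d a b = IsFaceOf C d a × IsFaceOf C d b

Geometric : PrecubicalSet → Set
Geometric C =
  (∀ {m n} (φ ψ : Word m n) (c : cell C n) → iface C φ c ≡ iface C ψ c → φ ≡ ψ) ×
  (∀ {n n'} (a : cell C n) (b : cell C n') →
     Σ ℕ (λ k → Σ (cell C k) (λ d → CommonFace C d a b)) →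
     Σ ℕ (λ k → Σ (cell C k) (λ d → CommonFace C d a b ×
        (∀ {k'} (e : cell C k') → CommonFace C e a b → IsFaceOf C e d))))

-- The top cube 0^n (all zeros); ∂Yn = cubes that are not of this form.
data Full : ∀ {k n} → Word k n → Set where
  [] : Full []
  z∷_ : ∀ {k n} {w : Word k n} → Full w → Full (z∷ w)

InBoundary : ∀ {k n} → Word k n → Set
InBoundary w = ¬ Full w

NoParallelEdges : PrecubicalSet → Set
NoParallelEdges C = (a b : cell C 1) →
  face C zero minus a ≡ face C zero minus b → face C zero plus a ≡ face C zero plus b → a ≡ b

-- Y2 \ {v}: cubes of Y2 not having v as an iterated face.
AvoidsVertex : Word 0 2 → ∀ {k} → Word k 2 → Set
AvoidsVertex v w = ¬ IsFaceOf (Y 2) v w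

AtMostOneSquareClosing : PrecubicalSet → Set
AtMostOneSquareClosing C = (v : Word 0 2) → LiftsAtMostOnce (Y 2) (AvoidsVertex v) C

-- Two cubes of a geometric precubical set that agree on two distinct facets are equal:
-- their maximal common face d contains both facets, so d has the dimension of the facets
-- or of the cubes. In the first case both facets would be the same iterated face d,
-- contradicting faithfulness; in the second d is each cube itself. Two extensions of a
-- morphism defined on the boundary of Yn (resp. on Y2 minus a vertex) agree on two
-- distinct facets of the top cube, hence on the top cube and then on all of its faces.
module Submission where

open import Defs
open import Data.Nat using (ℕ; zero; suc; _≤_; z≤n; s≤s)
open import Data.Nat.Properties using (≤-trans; ≤-antisym; n≤1+n; 1+n≰n; m≤n⇒m<n∨m≡n; m<1+n⇒m≤n)
open import Data.Fin using (Fin) renaming (zero to fzero; suc to fsuc)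
open import Data.Product using (_×_; _,_)
open import Data.Sum using (inj₁; inj₂)
open import Data.Empty using (⊥-elim)
open import Relation.Nullary using (Dec; yes; no)
open import Relation.Binary.PropositionalEquality using (_≡_; _≢_; refl; sym; trans; cong; module ≡-Reasoning)

Word⇒≤ : ∀ {m n} → Word m n → m ≤ n
Word⇒≤ [] = z≤n
Word⇒≤ (e ∷s w) = ≤-trans (Word⇒≤ w) (n≤1+n _)
Word⇒≤ (z∷ w) = s≤s (Word⇒≤ w)

act-square : (D : ℕ → Set) (f : ∀ {n} → Fin (suc n) → Sign → D (suc n) → D n) →
  ∀ {n} (w : Word n n) (x : D n) → act D f w x ≡ x
act-square D f [] x = refl
act-square D f (e ∷s w) x = ⊥-elim (1+n≰n (Word⇒≤ w))
act-square D f (z∷ w) x = act-square (λ k → D (suc k)) (λ i e → f (fsuc i) e) w x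

iface-square : (C : PrecubicalSet) → ∀ {n} (w : Word n n) (c : cell C n) → iface C w c ≡ c
iface-square C = act-square (cell C) (face C)

cube-determined-by-two-facets : (C : PrecubicalSet) → Geometric C →
  ∀ {m} {c c' : cell C (suc m)} (φ ψ : Word m (suc m)) → φ ≢ ψ →
  iface C φ c ≡ iface C φ c' → iface C ψ c ≡ iface C ψ c' → c ≡ c'
cube-determined-by-two-facets C (faithful , maximal) {m} {c} {c'} φ ψ φ≢ψ φc≡φc' ψc≡ψc'
  with maximal c c' (m , iface C φ c , (φ , refl) , (φ , sym φc≡φc'))
... | k , d , ((χ , χc≡d) , (χ' , χ'c'≡d)) , greatest
  with greatest _ ((φ , refl) , (φ , sym φc≡φc')) | greatest _ ((ψ , refl) , (ψ , sym ψc≡ψc'))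
... | φ₀ , φ₀d≡φc | ψ₀ , ψ₀d≡ψc with m≤n⇒m<n∨m≡n (Word⇒≤ χ)
...   | inj₂ refl = begin
  c              ≡⟨ sym (iface-square C χ c) ⟩
  iface C χ c    ≡⟨ χc≡d ⟩
  d              ≡⟨ sym χ'c'≡d ⟩
  iface C χ' c'  ≡⟨ iface-square C χ' c' ⟩
  c'             ∎
  where open ≡-Reasoning
...   | inj₁ k<1+m with ≤-antisym (Word⇒≤ φ₀) (m<1+n⇒m≤n k<1+m)
...     | refl = ⊥-elim (φ≢ψ (faithful φ ψ c (begin
  iface C φ c    ≡⟨ sym φ₀d≡φc ⟩
  iface C φ₀ d   ≡⟨ iface-square C φ₀ d ⟩
  d              ≡⟨ sym (iface-square C ψ₀ d) ⟩
  iface C ψ₀ d   ≡⟨ ψ₀d≡ψc ⟩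
  iface C ψ c    ∎)))
  where open ≡-Reasoning

module Extensions {A C : PrecubicalSet} {P : ∀ {k} → cell A k → Set} (f : SubMorphism A P C)
  (g g' : Morphism A C) (g-ext : Extends g f) (g'-ext : Extends g' f) where

  agree-on-sub : ∀ {k} (a : cell A k) → P a → map g a ≡ map g' a
  agree-on-sub a p = trans (g-ext a p) (sym (g'-ext a p))

  agree-on-face : ∀ {k} (i : Fin (suc k)) (e : Sign) (a : cell A (suc k)) → P (face A i e a) →
    face C i e (map g a) ≡ face C i e (map g' a)
  agree-on-face i e a p = begin
    face C i e (map g a)    ≡⟨ sym (commute g i e a) ⟩
    map g (face A i e a)    ≡⟨ agree-on-sub (face A i e a) p ⟩
    map g' (face A i e a)   ≡⟨ commute g' i e a ⟩
    face C i e (map g' a)   ∎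
    where open ≡-Reasoning

  face-preserves-agreement : ∀ {k} (i : Fin (suc k)) (e : Sign) (a : cell A (suc k)) →
    map g a ≡ map g' a → map g (face A i e a) ≡ map g' (face A i e a)
  face-preserves-agreement i e a ga≡g'a = begin
    map g (face A i e a)    ≡⟨ commute g i e a ⟩
    face C i e (map g a)    ≡⟨ cong (face C i e) ga≡g'a ⟩
    face C i e (map g' a)   ≡⟨ sym (commute g' i e a) ⟩
    map g' (face A i e a)   ∎
    where open ≡-Reasoning

top : (m : ℕ) → Word m m
top zero = []
top (suc m) = z∷ top m

Full? : ∀ {k n} (w : Word k n) → Dec (Full w)
Full? [] = yes []
Full? (e ∷s w) = no (λ ())
Full? (z∷ w) with Full? w
... | yes p = yes (z∷ p)
... | no ¬p = no (λ { (z∷ p) → ¬p p })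

yface-inBoundary : ∀ {k n} (i : Fin (suc k)) (e : Sign) (w : Word (suc k) n) → InBoundary (yface i e w)
yface-inBoundary i e (x ∷s w) ()
yface-inBoundary fzero e (z∷ w) ()
yface-inBoundary {suc k} (fsuc i) e (z∷ w) (z∷ p) = yface-inBoundary i e w p

liftsAtMostOnce-boundary : (C : PrecubicalSet) → Geometric C →
  (n : ℕ) → 1 ≤ n → LiftsAtMostOnce (Y n) InBoundary C
liftsAtMostOnce-boundary C geo (suc n) _ f g g' g-ext g'-ext a with Full? a
... | no ¬full = agree-on-sub a ¬full
  where open Extensions f g g' g-ext g'-ext
... | yes (z∷ _) =
  -- iface C (ε ∷s top m) x computes to iface C (top m) (face C fzero ε x)
  cube-determined-by-two-facets C geo (minus ∷s top _) (plus ∷s top _) (λ ())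
    (cong (iface C (top _)) (agree-on-face fzero minus a (yface-inBoundary fzero minus a)))
    (cong (iface C (top _)) (agree-on-face fzero plus a (yface-inBoundary fzero plus a)))
  where open Extensions f g g' g-ext g'-ext

noParallelEdges : (C : PrecubicalSet) → Geometric C → NoParallelEdges C
noParallelEdges C geo a b = cube-determined-by-two-facets C geo (minus ∷s []) (plus ∷s []) (λ ())

opposite : Sign → Sign
opposite minus = plus
opposite plus = minus

opposite-edge₀-avoids : (a b : Sign) → AvoidsVertex (a ∷s (b ∷s [])) (opposite a ∷s (z∷ []))
opposite-edge₀-avoids minus b (e ∷s [] , ())
opposite-edge₀-avoids plus b (e ∷s [] , ())

opposite-edge₁-avoids : (a b : Sign) → AvoidsVertex (a ∷s (b ∷s [])) (z∷ (opposite b ∷s []))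
opposite-edge₁-avoids a minus (e ∷s [] , ())
opposite-edge₁-avoids a plus (e ∷s [] , ())

atMostOneSquareClosing : (C : PrecubicalSet) → Geometric C → AtMostOneSquareClosing C
atMostOneSquareClosing C geo (a ∷s (b ∷s [])) f g g' g-ext g'-ext = agree
  where
  open Extensions f g g' g-ext g'-ext
  square : Word 2 2
  square = z∷ z∷ []
  agree-on-square : map g square ≡ map g' square
  agree-on-square = cube-determined-by-two-facets C geo (opposite a ∷s (z∷ [])) (z∷ (opposite b ∷s [])) (λ ())
    (agree-on-face fzero (opposite a) square (opposite-edge₀-avoids a b))
    (agree-on-face (fsuc fzero) (opposite b) square (opposite-edge₁-avoids a b))
  agree : ∀ {k} (w : Word k 2) → map g w ≡ map g' w
  agree (z∷ z∷ []) = agree-on-square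
  agree (e ∷s (z∷ [])) = face-preserves-agreement fzero e square agree-on-square
  agree (z∷ (e ∷s [])) = face-preserves-agreement (fsuc fzero) e square agree-on-square
  agree (e ∷s (e' ∷s [])) = face-preserves-agreement fzero e' (e ∷s (z∷ [])) (agree (e ∷s (z∷ [])))

lemma1p27 : (C : PrecubicalSet) → Geometric C →
    ((n : ℕ) → 1 ≤ n → LiftsAtMostOnce (Y n) InBoundary C) ×
    NoParallelEdges C × AtMostOneSquareClosing C
lemma1p27 C geo = liftsAtMostOnce-boundary C geo , noParallelEdges C geo , atMostOneSquareClosing C geo
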